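{- For every Cayley tree $T$ labelled with $[n]_0$, the weary permutation of $T$ coincides with the bird's eye permutation of its preference sequence: $\omega_T=\omega_{\pi_T}$.
   Context: A Cayley tree labelled with $[n]_0=\{0,\dots,n\}$ is a tree on vertex set $[n]_0$ rooted at $0$, with parent map $f_T$. Weary permutation $\omega_T$: run priority-first search from $0$ (at each step visit the smallest unvisited vertex adjacent to a visited vertex); $\omega_T(i)$ is the $i$-th non-root vertex visited, $\omega_T(0)=0$. The preference sequence is $\pi_T(i)=\omega_T^{ -1}(f_T(i))+1$, $i\in[n]$; it is a parking function. For a parking function $\pi=(a_1,\dots,a_n)$ (cars $1,\dots,n$ enter in order a street with spots $1,\dots,n$, car $i$ parks in the first free spot $j\ge a_i$, and all cars park), the bird's eye permutation $\omega_\pi$ is given by $\omega_\pi(j)$ = the car parked in spot $j$, with $\omega_\pi(0)=0$. -}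

module Defs where

open import Data.Nat using (ℕ; zero; suc; _≤ᵇ_; _+_)
open import Data.Fin using (Fin; zero; suc; toℕ)
open import Data.Fin.Properties using (_≟_)
open import Data.Bool using (Bool; true; false; _∧_; _∨_; not; if_then_else_)
open import Data.List using (List; []; _∷_; _++_; head)
open import Data.List.Base using (allFin; lookup; length)
open import Data.Maybe using (Maybe; just; nothing; map; fromMaybe)
open import Data.Product using (∃)
open import Relation.Nullary using (does)
open import Relation.Binary.PropositionalEquality using (_≡_)
open import Function using (_∘_)

-- Vertex set [n]_0 is Fin (suc n), with vertex 0 = zero (the root) and
-- vertex k (1 ≤ k ≤ n) = suc (k-1).  A labelled rooted tree is given by its
-- parent map f_T on the non-root vertices: f i = parent of vertex (suc i).

parent : {n : ℕ} → (Fin n → Fin (suc n)) → Fin (suc n) → Fin (suc n)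
parent f zero    = zero
parent f (suc i) = f i

iter : {A : Set} → (A → A) → ℕ → A → A
iter g zero    x = x
iter g (suc k) x = g (iter g (k) x)

-- f is the parent map of a Cayley tree on [n]_0 rooted at 0:
-- following parents from every vertex eventually reaches the root
-- (equivalently, the graph with edges {v, f v} is a tree rooted at 0).
IsCayleyTree : {n : ℕ} → (Fin n → Fin (suc n)) → Set
IsCayleyTree {n} f = (i : Fin n) → ∃ λ k → iter (parent f) k (suc i) ≡ zero

any : {A : Set} → (A → Bool) → List A → Bool
any p []       = false
any p (x ∷ xs) = p x ∨ any p xs

filter : {A : Set} → (A → Bool) → List A → List A
filter p []       = []
filter p (x ∷ xs) = if p x then x ∷ filter p xs else filter p xs

_==_ : {m : ℕ} → Fin m → Fin m → Bool
u == v = does (u ≟ v)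

isZero : {m : ℕ} → Fin (suc m) → Bool
isZero zero    = true
isZero (suc _) = false

adjacent : {n : ℕ} → (Fin n → Fin (suc n)) → Fin (suc n) → Fin (suc n) → Bool
adjacent f u v = (not (isZero u) ∧ (parent f u == v)) ∨ (not (isZero v) ∧ (parent f v == u))

elem : {m : ℕ} → Fin m → List (Fin m) → Bool
elem v vs = any (v ==_) vs

nextVertex : {n : ℕ} → (Fin n → Fin (suc n)) → List (Fin (suc n)) → Maybe (Fin (suc n))
nextVertex {n} f visited =
  head (filter (λ v → not (elem v visited) ∧ any (adjacent f v) visited) (allFin (suc n)))

pfs : {n : ℕ} → (Fin n → Fin (suc n)) → ℕ → List (Fin (suc n)) → List (Fin (suc n))
pfs f zero    visited = visited
pfs f (suc k) visited with nextVertex f visited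
... | nothing = visited
... | just v  = pfs f k (visited ++ (v ∷ []))

visitOrder : {n : ℕ} → (Fin n → Fin (suc n)) → List (Fin (suc n))
visitOrder {n} f = pfs f n (zero ∷ [])

-- list lookup with default zero (never used out of range for trees)
nth : {m : ℕ} → List (Fin (suc m)) → ℕ → Fin (suc m)
nth []       _       = zero
nth (x ∷ xs) zero    = x
nth (x ∷ xs) (suc k) = nth xs k

weary : {n : ℕ} → (Fin n → Fin (suc n)) → Fin (suc n) → Fin (suc n)
weary f i = nth (visitOrder f) (toℕ i)

position : {m : ℕ} → Fin m → List (Fin m) → ℕ
position v []       = zero
position v (x ∷ xs) = if v == x then zero else suc (position v xs)

-- preference sequence π_T(i) = ω_T^{-1}(f_T(i)) + 1, for car i (i.e. vertex suc i)
preference : {n : ℕ} → (Fin n → Fin (suc n)) → Fin n → ℕ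
preference f i = suc (position (f i) (visitOrder f))

-- Parking.  Spots 1..n are Fin n (spot j is toℕ j + 1); cars 1..n are Fin n
-- (car c is label toℕ c + 1).  A street state records the car in each spot.
Street : ℕ → Set
Street n = Fin n → Maybe (Fin n)

emptyStreet : {n : ℕ} → Street n
emptyStreet _ = nothing

isFree : {n : ℕ} → Street n → Fin n → Bool
isFree s j with s j
... | nothing = true
... | just _  = false

firstFree : {n : ℕ} → Street n → ℕ → Maybe (Fin n)
firstFree {n} s a = head (filter (λ j → (a ≤ᵇ suc (toℕ j)) ∧ isFree s j) (allFin n))

parkCar : {n : ℕ} → Fin n → ℕ → Street n → Street n
parkCar c a s with firstFree s a
... | nothing = s
... | just j  = λ k → if k == j then just c else s k

parkAll : {n : ℕ} → (Fin n → ℕ) → List (Fin n) → Street n → Street n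
parkAll a []       s = s
parkAll a (c ∷ cs) s = parkAll a cs (parkCar c (a c) s)

parkingOutcome : {n : ℕ} → (Fin n → ℕ) → Street n
parkingOutcome {n} a = parkAll a (allFin n) emptyStreet

-- bird's eye permutation as a partial map on [n]_0 (cars as vertices suc c):
-- ω_π(0) = 0, ω_π(j) = car parked in spot j (nothing if spot j is empty)
birdsEye : {n : ℕ} → (Fin n → ℕ) → Fin (suc n) → Maybe (Fin (suc n))
birdsEye a zero    = just zero
birdsEye a (suc j) = map suc (parkingOutcome a j)

module Submission where

-- Priority-first search visits a vertex v only after its parent, and every vertex visited
-- strictly between the parent of v and v is smaller than v: v was already available at
-- that time, and the search always takes the smallest available vertex.  Read through the
-- preference sequence, car v prefers the spot right after its parent's position, the spots
-- from there up to v's own position in ω_T are occupied by smaller, hence earlier, cars,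
-- and v's own spot is still free.  So every car parks exactly where ω_T places it.

open import Defs
open import Data.Bool using (Bool; true; false; T; not; _∧_)
open import Data.Bool.Properties using (T-≡; T-∧; T-∨)
open import Data.Empty using (⊥-elim)
open import Data.Fin using (Fin; zero; suc; toℕ; fromℕ<; punchOut)
open import Data.Fin.Permutation
  using (Permutation′; permutation; _⟨$⟩ʳ_; _⟨$⟩ˡ_; inverseˡ; inverseʳ; remove; lift₀-remove)
open import Data.Fin.Properties
  using (_≟_; toℕ-injective; toℕ<n; toℕ-fromℕ<; fromℕ<-injective; punchOut-injective; injective⇒≤)
open import Data.List using (List; []; _∷_; _++_; head; length; tabulate)
open import Data.List.Properties using (length-++)
open import Data.Maybe using (just; nothing; map)
open import Data.Maybe.Properties using (just-injective)
open import Data.Nat using (ℕ; zero; suc; _+_; _≤_; _≤ᵇ_; _<_; z≤n; s≤s; z<s; s<s; s≤s⁻¹; s<s⁻¹)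
open import Data.Nat.Properties
  using (+-comm; +-suc; +-identityʳ; n≮0; n≤1+n; 1+n≰n; m≤m+n; _<?_; ≤⇒≤ᵇ; ≤ᵇ⇒≤; ≤-refl; ≤-trans
        ; ≤-reflexive; ≤-antisym; <-trans; <⇒≤; <⇒≢; <⇒≱; ≮⇒≥; ≤∧≢⇒<; m<1+n⇒m<n∨m≡n)
open import Data.Product using (∃; _×_; _,_; proj₁; proj₂)
open import Data.Sum using (_⊎_; inj₁; inj₂; map₁)
open import Data.Unit using (tt)
open import Function using (_∘_; id; Equivalence)
open import Relation.Nullary using (¬_; yes; no)
open import Relation.Binary.PropositionalEquality
  using (_≡_; _≢_; refl; sym; trans; cong; subst; subst₂; module ≡-Reasoning)
open ≡-Reasoning

open Equivalence using (to; from)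

module _ {A : Set} (p : A → Bool) where

  head-filter-tabulate : ∀ {m} (g : Fin m → A) i → T (p (g i)) →
    (∀ j → toℕ j < toℕ i → ¬ T (p (g j))) → head (filter p (tabulate g)) ≡ just (g i)
  head-filter-tabulate g zero pgi _ with p (g zero)
  ... | true = refl
  head-filter-tabulate g (suc i) pgi earlier with p (g zero) | earlier zero z<s
  ... | true  | ¬pg0 = ⊥-elim (¬pg0 tt)
  ... | false | _    = head-filter-tabulate (g ∘ suc) i pgi (λ j j<i → earlier (suc j) (s<s j<i))

  head-filter-tabulate⁻ : ∀ {m} (g : Fin m → A) {v} → head (filter p (tabulate g)) ≡ just v →
    ∃ λ i → g i ≡ v × T (p (g i)) × (∀ j → toℕ j < toℕ i → ¬ T (p (g j)))
  head-filter-tabulate⁻ {suc m} g eq with p (g zero) in pg0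
  ... | true  = zero , just-injective eq , T-≡ .from pg0 , λ _ ()
  ... | false with head-filter-tabulate⁻ (g ∘ suc) eq
  ...   | i , gi≡v , pgi , earlier = suc i , gi≡v , pgi , earlier′
    where
    earlier′ : ∀ j → toℕ j < toℕ (suc i) → ¬ T (p (g j))
    earlier′ zero    _     = subst T pg0
    earlier′ (suc j) j<i   = earlier j (s<s⁻¹ j<i)

  head-filter-tabulate-nothing : ∀ {m} (g : Fin m → A) → head (filter p (tabulate g)) ≡ nothing →
    ∀ i → ¬ T (p (g i))
  head-filter-tabulate-nothing g eq zero with p (g zero)
  ... | false = λ ()
  head-filter-tabulate-nothing g eq (suc i) with p (g zero)
  ... | false = head-filter-tabulate-nothing (g ∘ suc) eq i

module _ {m : ℕ} where

  ==⇒≡ : {u v : Fin m} → T (u == v) → u ≡ v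
  ==⇒≡ {u} {v} t with u ≟ v
  ... | yes u≡v = u≡v

  ==-refl : (u : Fin m) → T (u == u)
  ==-refl u with u ≟ u
  ... | yes _   = tt
  ... | no u≢u = u≢u refl

  -- position returns length xs on elements that do not occur
  infix 4 _∈_
  _∈_ : Fin m → List (Fin m) → Set
  u ∈ xs = position u xs < length xs

  ∈-here : ∀ x xs → x ∈ x ∷ xs
  ∈-here x xs with x == x | ==-refl x
  ... | true | _ = z<s

  any⁻ : ∀ p xs → T (any p xs) → ∃ λ u → u ∈ xs × T (p u)
  any⁻ p (x ∷ xs) t with p x in px
  ... | true  = x , ∈-here x xs , T-≡ .from px
  ... | false with any⁻ p xs t
  ...   | u , u∈xs , pu = u , ∈-there u∈xs , pu
    where
    ∈-there : ∀ {u} → u ∈ xs → u ∈ x ∷ xs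
    ∈-there {u} u∈xs with u == x
    ... | true  = z<s
    ... | false = s<s u∈xs

  any⁺ : ∀ p {u} xs → u ∈ xs → T (p u) → T (any p xs)
  any⁺ p {u} (x ∷ xs) u∈ pu with u == x in u=x
  ... | true  = T-∨ .from (inj₁ (subst (T ∘ p) (==⇒≡ (T-≡ .from u=x)) pu))
  ... | false = T-∨ .from (inj₂ (any⁺ p xs (s<s⁻¹ u∈) pu))

  elem⁻ : ∀ {u} xs → T (elem u xs) → u ∈ xs
  elem⁻ xs t with any⁻ _ xs t
  ... | w , w∈xs , u=w = subst (_∈ xs) (sym (==⇒≡ u=w)) w∈xs

  elem⁺ : ∀ {u} xs → u ∈ xs → T (elem u xs)
  elem⁺ {u} xs u∈xs = any⁺ (u ==_) xs u∈xs (==-refl u)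

  ∉⇒not-elem : ∀ {u} xs → ¬ u ∈ xs → T (not (elem u xs))
  ∉⇒not-elem {u} xs u∉ with elem u xs in u∈?
  ... | true  = u∉ (elem⁻ xs (T-≡ .from u∈?))
  ... | false = tt

  not-elem⇒∉ : ∀ {u} xs → T (not (elem u xs)) → ¬ u ∈ xs
  not-elem⇒∉ {u} xs u∉ u∈ with elem u xs | elem⁺ xs u∈
  ... | true | _ = u∉

  ∈-++ˡ : ∀ {u} xs ys → u ∈ xs → u ∈ xs ++ ys
  ∈-++ˡ {u} (x ∷ xs) ys u∈ with u == x
  ... | true  = z<s
  ... | false = s<s (∈-++ˡ xs ys (s<s⁻¹ u∈))

  position-++ˡ : ∀ {u : Fin m} xs ys → u ∈ xs → position u (xs ++ ys) ≡ position u xs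
  position-++ˡ {u} (x ∷ xs) ys u∈ with u == x
  ... | true  = refl
  ... | false = cong suc (position-++ˡ xs ys (s<s⁻¹ u∈))

  ≤-position-++ : ∀ {u : Fin m} {k} xs ys → k ≤ length xs → k ≤ position u (xs ++ ys) → k ≤ position u xs
  ≤-position-++ {k = zero} xs ys _ _ = z≤n
  ≤-position-++ {u} (x ∷ xs) ys (s≤s k≤) k≤p with u == x
  ... | true  = k≤p
  ... | false = s≤s (≤-position-++ xs ys k≤ (s≤s⁻¹ k≤p))

  position-++-< : ∀ {u : Fin m} {k} xs ys → k ≤ length xs → position u (xs ++ ys) < k → position u xs < k
  position-++-< {u} (x ∷ xs) ys (s≤s k≤) p< with u == x
  ... | true  = p<
  ... | false = s<s (position-++-< xs ys k≤ (s<s⁻¹ p<))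

  position-snoc : ∀ {v : Fin m} xs → ¬ v ∈ xs → position v (xs ++ v ∷ []) ≡ length xs
  position-snoc {v} [] _ with v == v | ==-refl v
  ... | true | _ = refl
  position-snoc {v} (x ∷ xs) v∉ with v == x
  ... | true  = ⊥-elim (v∉ z<s)
  ... | false = cong suc (position-snoc xs (v∉ ∘ s<s))

  ∈-snoc⁻ : ∀ {u v : Fin m} xs → u ∈ xs ++ v ∷ [] → u ∈ xs ⊎ u ≡ v
  ∈-snoc⁻ {u} {v} [] u∈ with u == v in u=v
  ... | true  = inj₂ (==⇒≡ (T-≡ .from u=v))
  ... | false with u∈
  ...   | s<s ()
  ∈-snoc⁻ {u} (x ∷ xs) u∈ with u == x
  ... | true  = inj₁ z<s
  ... | false = map₁ s<s (∈-snoc⁻ xs (s<s⁻¹ u∈))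

  length-snoc : ∀ xs (v : Fin m) → length (xs ++ v ∷ []) ≡ suc (length xs)
  length-snoc xs v = trans (length-++ xs) (+-comm (length xs) 1)

module _ {m : ℕ} where

  nth-++ˡ : ∀ (xs ys : List (Fin (suc m))) k → k < length xs → nth (xs ++ ys) k ≡ nth xs k
  nth-++ˡ (x ∷ xs) ys zero    _  = refl
  nth-++ˡ (x ∷ xs) ys (suc k) k< = nth-++ˡ xs ys k (s<s⁻¹ k<)

  nth-snoc : ∀ xs (v : Fin (suc m)) → nth (xs ++ v ∷ []) (length xs) ≡ v
  nth-snoc []       v = refl
  nth-snoc (x ∷ xs) v = nth-snoc xs v

  nth-position : ∀ {u : Fin (suc m)} xs → u ∈ xs → nth xs (position u xs) ≡ u
  nth-position {u} (x ∷ xs) u∈ with u == x in u=x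
  ... | true  = sym (==⇒≡ (T-≡ .from u=x))
  ... | false = nth-position xs (s<s⁻¹ u∈)

  NoDup : List (Fin (suc m)) → Set
  NoDup xs = ∀ k → k < length xs → position (nth xs k) xs ≡ k

  length≥-of-complete : ∀ xs → (∀ u → u ∈ xs) → suc m ≤ length xs
  length≥-of-complete xs complete = injective⇒≤ index-injective
    where
    index : Fin (suc m) → Fin (length xs)
    index u = fromℕ< (complete u)
    index-injective : ∀ {u v} → index u ≡ index v → u ≡ v
    index-injective {u} {v} eq = begin
      u                        ≡⟨ sym (nth-position xs (complete u)) ⟩
      nth xs (position u xs)   ≡⟨ cong (nth xs) (fromℕ<-injective _ _ (complete u) (complete v) eq) ⟩
      nth xs (position v xs)   ≡⟨ nth-position xs (complete v) ⟩
      v                        ∎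

  complete-of-length : ∀ xs → NoDup xs → length xs ≡ suc m → ∀ u → u ∈ xs
  complete-of-length xs nodup len u with position u xs <? length xs
  ... | yes u∈ = u∈
  ... | no  u∉ = ⊥-elim (1+n≰n (injective⇒≤ squeeze-injective))
    where
    in-range : (k : Fin (suc m)) → toℕ k < length xs
    in-range k = subst (toℕ k <_) (sym len) (toℕ<n k)
    u≢entry : (k : Fin (suc m)) → u ≢ nth xs (toℕ k)
    u≢entry k refl = u∉ (subst (_< length xs) (sym (nodup (toℕ k) (in-range k))) (in-range k))
    squeeze : Fin (suc m) → Fin m
    squeeze k = punchOut (u≢entry k)
    squeeze-injective : ∀ {i j} → squeeze i ≡ squeeze j → i ≡ j
    squeeze-injective {i} {j} eq = toℕ-injective (begin
      toℕ i                          ≡⟨ sym (nodup (toℕ i) (in-range i)) ⟩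
      position (nth xs (toℕ i)) xs
        ≡⟨ cong (λ w → position w xs) (punchOut-injective (u≢entry i) (u≢entry j) eq) ⟩
      position (nth xs (toℕ j)) xs   ≡⟨ nodup (toℕ j) (in-range j) ⟩
      toℕ j                          ∎)

module PrioritySearch {n : ℕ} (f : Fin n → Fin (suc n)) where

  available : List (Fin (suc n)) → Fin (suc n) → Bool
  available vs v = not (elem v vs) ∧ any (adjacent f v) vs

  adjacent-parent : ∀ u → u ≢ zero → T (adjacent f u (parent f u))
  adjacent-parent zero    u≢0 = ⊥-elim (u≢0 refl)
  adjacent-parent (suc i) _   = T-∨ .from (inj₁ (==-refl (f i)))

  adjacent⁻ : ∀ u v → T (adjacent f u v) → parent f u ≡ v ⊎ (v ≢ zero × parent f v ≡ u)
  adjacent⁻ u v adj with T-∨ {not (isZero u) ∧ (parent f u == v)} .to adj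
  ... | inj₁ up   = inj₁ (==⇒≡ (proj₂ (T-∧ {not (isZero u)} .to up)))
  ... | inj₂ down = inj₂ (v≢0 , ==⇒≡ (proj₂ (T-∧ {not (isZero v)} .to down)))
    where
    v≢0 : v ≢ zero
    v≢0 refl = down

  record IsSearchPrefix (vs : List (Fin (suc n))) : Set where
    field
      root-visited  : zero ∈ vs
      root-first    : position zero vs ≡ 0
      nodup         : NoDup vs
      parent-before : ∀ u → u ∈ vs → u ≢ zero → position (parent f u) vs < position u vs
      greedy        : ∀ w u → w ∈ vs → position w vs ≤ position u vs →
                      position (parent f u) vs < position w vs → toℕ w ≤ toℕ u

  root-isSearchPrefix : IsSearchPrefix (zero ∷ [])
  root-isSearchPrefix = record
    { root-visited  = z<s
    ; root-first    = refl
    ; nodup         = λ { zero _ → refl ; (suc k) (s<s ()) }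
    ; parent-before = λ u u∈ u≢0 → ⊥-elim (u≢0 (only-root u∈))
    ; greedy        = greedy₀
    }
    where
    only-root : ∀ {u} → u ∈ zero ∷ [] → u ≡ zero
    only-root u∈ with ∈-snoc⁻ [] u∈
    ... | inj₂ u≡0 = u≡0
    greedy₀ : ∀ w u → w ∈ zero ∷ [] → position w (zero ∷ []) ≤ position u (zero ∷ []) →
              position (parent f u) (zero ∷ []) < position w (zero ∷ []) → toℕ w ≤ toℕ u
    greedy₀ w u w∈ _ pu<w with only-root {w} w∈
    ... | refl = ⊥-elim (n≮0 pu<w)

  module _ {vs : List (Fin (suc n))} (search : IsSearchPrefix vs) where
    open IsSearchPrefix search

    available-intro : ∀ {u} → ¬ u ∈ vs → parent f u ∈ vs → T (available vs u)
    available-intro {u} u∉ pu∈ =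
      T-∧ .from (∉⇒not-elem vs u∉ , any⁺ (adjacent f u) vs pu∈ (adjacent-parent u u≢0))
      where
      u≢0 : u ≢ zero
      u≢0 refl = u∉ root-visited

    available-elim : ∀ {v} → T (available vs v) → ¬ v ∈ vs × parent f v ∈ vs
    available-elim {v} avail with T-∧ .to avail
    ... | not-visited , has-neighbour with any⁻ (adjacent f v) vs has-neighbour
    ...   | u , u∈ , adj = v∉ , parent-visited (adjacent⁻ v u adj)
      where
      v∉ : ¬ v ∈ vs
      v∉ = not-elem⇒∉ vs not-visited
      parent-visited : parent f v ≡ u ⊎ (u ≢ zero × parent f u ≡ v) → parent f v ∈ vs
      parent-visited (inj₁ refl)        = u∈
      parent-visited (inj₂ (u≢0 , refl)) = ⊥-elim (v∉ (<-trans (parent-before u u∈ u≢0) u∈))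

    visited-between-parent-and-child : ∀ u l → u ∈ vs → position (parent f u) vs < l → l < position u vs →
                                       toℕ (nth vs l) < toℕ u
    visited-between-parent-and-child u l u∈ pu<l l<u = ≤∧≢⇒< w≤u w≢u
      where
      w : Fin (suc n)
      w = nth vs l
      position-w : position w vs ≡ l
      position-w = nodup l (<-trans l<u u∈)
      w≤u : toℕ w ≤ toℕ u
      w≤u = greedy w u (subst (_< length vs) (sym position-w) (<-trans l<u u∈))
                       (subst (_≤ position u vs) (sym position-w) (<⇒≤ l<u))
                       (subst (position (parent f u) vs <_) (sym position-w) pu<l)
      w≢u : toℕ w ≢ toℕ u
      w≢u w≡u = <⇒≢ l<u (trans (sym position-w) (cong (λ x → position x vs) (toℕ-injective w≡u)))

    complete-when-stuck : IsCayleyTree f → nextVertex f vs ≡ nothing → ∀ u → u ∈ vs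
    complete-when-stuck tree stuck zero    = root-visited
    complete-when-stuck tree stuck (suc i) with tree i
    ... | k , reaches-root = visited-if-ancestor-visited k (subst (_∈ vs) (sym reaches-root) root-visited)
      where
      child-visited : ∀ {u} → parent f u ∈ vs → u ∈ vs
      child-visited {u} pu∈ with position u vs <? length vs
      ... | yes u∈ = u∈
      ... | no  u∉ = ⊥-elim (head-filter-tabulate-nothing (available vs) id stuck u (available-intro u∉ pu∈))
      visited-if-ancestor-visited : ∀ {u} k → iter (parent f) k u ∈ vs → u ∈ vs
      visited-if-ancestor-visited zero    a∈ = a∈
      visited-if-ancestor-visited (suc k) a∈ = visited-if-ancestor-visited k (child-visited a∈)

    module Snoc {v : Fin (suc n)} (v∉ : ¬ v ∈ vs) (pv∈ : parent f v ∈ vs)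
                (v-least : ∀ u → toℕ u < toℕ v → ¬ T (available vs u)) where

      vs′ : List (Fin (suc n))
      vs′ = vs ++ v ∷ []

      position-old : ∀ {u} → u ∈ vs → position u vs′ ≡ position u vs
      position-old = position-++ˡ vs (v ∷ [])

      position-new : position v vs′ ≡ length vs
      position-new = position-snoc vs v∉

      index-cases : ∀ {k} → k < length vs′ → k < length vs ⊎ k ≡ length vs
      index-cases {k} k< = m<1+n⇒m<n∨m≡n (subst (k <_) (length-snoc vs v) k<)

      nodup′ : NoDup vs′
      nodup′ k k< with index-cases k<
      ... | inj₁ k<L = begin
        position (nth vs′ k) vs′   ≡⟨ cong (λ w → position w vs′) (nth-++ˡ vs (v ∷ []) k k<L) ⟩
        position (nth vs k) vs′    ≡⟨ position-old (subst (_< length vs) (sym (nodup k k<L)) k<L) ⟩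
        position (nth vs k) vs     ≡⟨ nodup k k<L ⟩
        k                          ∎
      ... | inj₂ refl = begin
        position (nth vs′ (length vs)) vs′   ≡⟨ cong (λ w → position w vs′) (nth-snoc vs v) ⟩
        position v vs′                       ≡⟨ position-new ⟩
        length vs                            ∎

      parent-before′ : ∀ u → u ∈ vs′ → u ≢ zero → position (parent f u) vs′ < position u vs′
      parent-before′ u u∈′ u≢0 with ∈-snoc⁻ vs u∈′
      ... | inj₁ u∈ = subst₂ _<_ (sym (position-old (<-trans pu<u u∈))) (sym (position-old u∈)) pu<u
        where
        pu<u : position (parent f u) vs < position u vs
        pu<u = parent-before u u∈ u≢0
      ... | inj₂ refl = subst₂ _<_ (sym (position-old pv∈)) (sym position-new) pv∈

      greedy′ : ∀ w u → w ∈ vs′ → position w vs′ ≤ position u vs′ →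
                position (parent f u) vs′ < position w vs′ → toℕ w ≤ toℕ u
      greedy′ w u w∈′ w≤u pu<w with ∈-snoc⁻ vs w∈′
      ... | inj₁ w∈ = greedy w u w∈
        (≤-position-++ vs _ (<⇒≤ w∈) (subst (_≤ position u vs′) (position-old w∈) w≤u))
        (position-++-< vs _ (<⇒≤ w∈) (subst (position (parent f u) vs′ <_) (position-old w∈) pu<w))
      ... | inj₂ refl = ≮⇒≥ (λ u<v → v-least u u<v (available-intro u∉ pu∈))
        where
        u∉ : ¬ u ∈ vs
        u∉ u∈ = <⇒≱ u∈ (≤-position-++ vs _ ≤-refl (subst (_≤ position u vs′) position-new w≤u))
        pu∈ : parent f u ∈ vs
        pu∈ = position-++-< vs _ ≤-refl (subst (position (parent f u) vs′ <_) position-new pu<w)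

      snoc-isSearchPrefix : IsSearchPrefix vs′
      snoc-isSearchPrefix = record
        { root-visited  = ∈-++ˡ vs _ root-visited
        ; root-first    = trans (position-old root-visited) root-first
        ; nodup         = nodup′
        ; parent-before = parent-before′
        ; greedy        = greedy′
        }

    extend : ∀ {v} → nextVertex f vs ≡ just v → IsSearchPrefix (vs ++ v ∷ [])
    extend next with head-filter-tabulate⁻ (available vs) id next
    ... | v , refl , avail , v-least with available-elim avail
    ...   | v∉ , pv∈ = Snoc.snoc-isSearchPrefix v∉ pv∈ v-least

  pfs-isSearchPrefix : ∀ k {vs} → IsSearchPrefix vs → IsSearchPrefix (pfs f k vs)
  pfs-isSearchPrefix zero    search = search
  pfs-isSearchPrefix (suc k) {vs} search with nextVertex f vs in next
  ... | nothing = search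
  ... | just v  = pfs-isSearchPrefix k (extend search next)

  length-snoc-+ : ∀ vs (v : Fin (suc n)) k → length (vs ++ v ∷ []) + k ≡ length vs + suc k
  length-snoc-+ vs v k = trans (cong (_+ k) (length-snoc vs v)) (sym (+-suc (length vs) k))

  length-pfs-≤ : ∀ k vs → length (pfs f k vs) ≤ length vs + k
  length-pfs-≤ zero    vs = ≤-reflexive (sym (+-identityʳ (length vs)))
  length-pfs-≤ (suc k) vs with nextVertex f vs
  ... | nothing = m≤m+n (length vs) (suc k)
  ... | just v  = ≤-trans (length-pfs-≤ k (vs ++ v ∷ [])) (≤-reflexive (length-snoc-+ vs v k))

  pfs-complete-or-full : IsCayleyTree f → ∀ k {vs} → IsSearchPrefix vs →
                         (∀ u → u ∈ pfs f k vs) ⊎ length (pfs f k vs) ≡ length vs + k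
  pfs-complete-or-full tree zero    search = inj₂ (sym (+-identityʳ _))
  pfs-complete-or-full tree (suc k) {vs} search with nextVertex f vs in next
  ... | nothing = inj₁ (complete-when-stuck search tree next)
  ... | just v  with pfs-complete-or-full tree k (extend search next)
  ...   | inj₁ complete = inj₁ complete
  ...   | inj₂ full     = inj₂ (trans full (length-snoc-+ vs v k))

module _ {n : ℕ} (s : Street n) (j : Fin n) where

  isFree-nothing : s j ≡ nothing → T (isFree s j)
  isFree-nothing eq rewrite eq = tt

  isFree-just : ∀ {c} → s j ≡ just c → ¬ T (isFree s j)
  isFree-just eq rewrite eq = λ ()

module Parking {n : ℕ} (a : Fin n → ℕ) (σ : Permutation′ n)
  (reachable : ∀ c → a c ≤ suc (toℕ (σ ⟨$⟩ˡ c)))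
  (blocked : ∀ c j → a c ≤ suc (toℕ j) → toℕ j < toℕ (σ ⟨$⟩ˡ c) → toℕ (σ ⟨$⟩ʳ j) < toℕ c) where

  ParkedBelow : ℕ → Street n → Set
  ParkedBelow c₀ s = ∀ j → (toℕ (σ ⟨$⟩ʳ j) < c₀ → s j ≡ just (σ ⟨$⟩ʳ j))
                         × (c₀ ≤ toℕ (σ ⟨$⟩ʳ j) → s j ≡ nothing)

  firstFree-spot : ∀ {c s c₀} → toℕ c ≡ c₀ → ParkedBelow c₀ s → firstFree s (a c) ≡ just (σ ⟨$⟩ˡ c)
  firstFree-spot {c} {s} refl parked = head-filter-tabulate _ id (σ ⟨$⟩ˡ c) fits earlier-taken
    where
    fits : T ((a c ≤ᵇ suc (toℕ (σ ⟨$⟩ˡ c))) ∧ isFree s (σ ⟨$⟩ˡ c))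
    fits = T-∧ .from (≤⇒≤ᵇ (reachable c) , isFree-nothing s (σ ⟨$⟩ˡ c)
                        (proj₂ (parked _) (≤-reflexive (cong toℕ (sym (inverseʳ σ))))))
    earlier-taken : ∀ j → toℕ j < toℕ (σ ⟨$⟩ˡ c) → ¬ T ((a c ≤ᵇ suc (toℕ j)) ∧ isFree s j)
    earlier-taken j j<k fits-j with T-∧ {a c ≤ᵇ suc (toℕ j)} .to fits-j
    ... | a≤j , free = isFree-just s j (proj₁ (parked j) (blocked c j (≤ᵇ⇒≤ _ _ a≤j) j<k)) free

  parkCar-step : ∀ c {c₀ s} → toℕ c ≡ c₀ → ParkedBelow c₀ s → ParkedBelow (suc c₀) (parkCar c (a c) s)
  parkCar-step c {c₀} {s} c≡c₀ parked j with firstFree s (a c) | firstFree-spot c≡c₀ parked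
  ... | just k | refl with j ≟ σ ⟨$⟩ˡ c
  ...   | yes refl = (λ _ → cong just (sym (inverseʳ σ))) ,
                     (λ c<σj → ⊥-elim (1+n≰n (subst (suc c₀ ≤_) (trans (cong toℕ (inverseʳ σ)) c≡c₀) c<σj)))
  ...   | no  j≢k  = (λ σj<1+c₀ → proj₁ (parked j) (≤∧≢⇒< (s≤s⁻¹ σj<1+c₀) σj≢c₀)) ,
                     (λ c₀<σj → proj₂ (parked j) (≤-trans (n≤1+n c₀) c₀<σj))
    where
    σj≢c₀ : toℕ (σ ⟨$⟩ʳ j) ≢ c₀
    σj≢c₀ eq = j≢k (trans (sym (inverseˡ σ)) (cong (σ ⟨$⟩ˡ_) (toℕ-injective (trans eq (sym c≡c₀)))))

  parkAll-step : ∀ {m} (cars : Fin m → Fin n) {c₀ s} → (∀ i → toℕ (cars i) ≡ c₀ + toℕ i) →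
                 ParkedBelow c₀ s → ParkedBelow (c₀ + m) (parkAll a (tabulate cars) s)
  parkAll-step {zero} cars {c₀} {s} _ parked = subst (λ k → ParkedBelow k s) (sym (+-identityʳ c₀)) parked
  parkAll-step {suc m} cars {c₀} {s} consecutive parked =
    subst (λ k → ParkedBelow k (parkAll a (tabulate cars) s)) (sym (+-suc c₀ m))
      (parkAll-step (cars ∘ suc) (λ i → trans (consecutive (suc i)) (+-suc c₀ (toℕ i)))
        (parkCar-step (cars zero) (trans (consecutive zero) (+-identityʳ c₀)) parked))

  parkingOutcome≡ : ∀ j → parkingOutcome a j ≡ just (σ ⟨$⟩ʳ j)
  parkingOutcome≡ j = proj₁ (parkAll-step id (λ _ → refl) nothing-parked j) (toℕ<n (σ ⟨$⟩ʳ j))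
    where
    nothing-parked : ParkedBelow 0 emptyStreet
    nothing-parked _ = (λ ()) , (λ _ → refl)

module VisitOrder {n : ℕ} {f : Fin n → Fin (suc n)} (tree : IsCayleyTree f) where
  open PrioritySearch f

  search : IsSearchPrefix (visitOrder f)
  search = pfs-isSearchPrefix n root-isSearchPrefix

  open IsSearchPrefix search

  visitOrder-complete×length : (∀ u → u ∈ visitOrder f) × length (visitOrder f) ≡ suc n
  visitOrder-complete×length with pfs-complete-or-full tree n root-isSearchPrefix
  ... | inj₁ complete =
    complete , ≤-antisym (length-pfs-≤ n (zero ∷ [])) (length≥-of-complete (visitOrder f) complete)
  ... | inj₂ full     = complete-of-length (visitOrder f) nodup full , full

  visited : ∀ u → u ∈ visitOrder f
  visited = proj₁ visitOrder-complete×length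

  position<1+n : ∀ u → position u (visitOrder f) < suc n
  position<1+n u = subst (position u (visitOrder f) <_) (proj₂ visitOrder-complete×length) (visited u)

  wearyPermutation : Permutation′ (suc n)
  wearyPermutation = permutation (weary f) (λ u → fromℕ< (position<1+n u)) weary-position position-weary
    where
    weary-position : ∀ u → weary f (fromℕ< (position<1+n u)) ≡ u
    weary-position u = trans (cong (nth (visitOrder f)) (toℕ-fromℕ< (position<1+n u)))
                             (nth-position (visitOrder f) (visited u))
    position-weary : ∀ i → fromℕ< (position<1+n (weary f i)) ≡ i
    position-weary i = toℕ-injective (trans (toℕ-fromℕ< _)
      (nodup (toℕ i) (subst (toℕ i <_) (sym (proj₂ visitOrder-complete×length)) (toℕ<n i))))

  weary-root : weary f zero ≡ zero
  weary-root = subst (λ k → nth (visitOrder f) k ≡ zero) root-first (nth-position (visitOrder f) root-visited)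

  wearyCars : Permutation′ n
  wearyCars = remove zero wearyPermutation

  weary-suc : ∀ j → weary f (suc j) ≡ suc (wearyCars ⟨$⟩ʳ j)
  weary-suc j = sym (lift₀-remove wearyPermutation weary-root (suc j))

  position-car : ∀ c → position (suc c) (visitOrder f) ≡ suc (toℕ (wearyCars ⟨$⟩ˡ c))
  position-car c = begin
    position (suc c) (visitOrder f)             ≡⟨ sym (toℕ-fromℕ< (position<1+n (suc c))) ⟩
    toℕ (wearyPermutation ⟨$⟩ˡ suc c)           ≡⟨ cong (toℕ ∘ (wearyPermutation ⟨$⟩ˡ_)) (sym weary-spot) ⟩
    toℕ (wearyPermutation ⟨$⟩ˡ weary f (suc k)) ≡⟨ cong toℕ (inverseˡ wearyPermutation) ⟩
    suc (toℕ k)                                 ∎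
    where
    k : Fin n
    k = wearyCars ⟨$⟩ˡ c
    weary-spot : weary f (suc k) ≡ suc c
    weary-spot = trans (weary-suc k) (cong suc (inverseʳ wearyCars))

  preference-reachable : ∀ c → preference f c ≤ suc (toℕ (wearyCars ⟨$⟩ˡ c))
  preference-reachable c = subst (position (f c) (visitOrder f) <_) (position-car c)
                                 (parent-before (suc c) (visited (suc c)) λ ())

  preference-blocked : ∀ c j → preference f c ≤ suc (toℕ j) → toℕ j < toℕ (wearyCars ⟨$⟩ˡ c) →
                       toℕ (wearyCars ⟨$⟩ʳ j) < toℕ c
  preference-blocked c j parent<j j<spot = s<s⁻¹ (subst (λ w → toℕ w < suc (toℕ c)) (weary-suc j)
    (visited-between-parent-and-child search (suc c) (suc (toℕ j)) (visited (suc c)) parent<j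
      (subst (suc (toℕ j) <_) (sym (position-car c)) (s<s j<spot))))

lemma3p12 : (n : ℕ) (f : Fin n → Fin (suc n)) → IsCayleyTree f →
    (j : Fin (suc n)) → birdsEye (preference f) j ≡ just (weary f j)
lemma3p12 n f tree zero    = cong just (sym weary-root)
  where open VisitOrder tree
lemma3p12 n f tree (suc j) = begin
  map suc (parkingOutcome (preference f) j)
    ≡⟨ cong (map suc) (parkingOutcome≡ (preference f) wearyCars preference-reachable preference-blocked j) ⟩
  just (suc (wearyCars ⟨$⟩ʳ j))
    ≡⟨ cong just (sym (weary-suc j)) ⟩
  just (weary f (suc j))
    ∎
  where
  open VisitOrder tree
  open Parking using (parkingOutcome≡)
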